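{- Let $G=(\Sigma,I,L,\rightarrow)$ be a transition system with $\Sigma$ finite. Let $I\subseteq\sigma_i\subseteq\mathrm{post}^*(I)$, and let $R_i$ be a preorder on $\Sigma$. Then every execution of Algorithm 5 (described in the context) on input $G,R_i,\sigma_i$ terminates.
   Context: Notation. - $G=(\Sigma,I,L,\rightarrow)$ has states $\Sigma$, initial states $I$, finite label set $L$, and transitions $x\xrightarrow{a}y$. - $\mathrm{pre}_a(Y)=\{x\mid\exists y\in Y.\ x\xrightarrow{a}y\}$. - $\mathrm{post}(X)=\{y\mid\exists x\in X,a.\ x\xrightarrow{a}y\}$ and $\mathrm{post}^*(X)=\bigcup_n\mathrm{post}^n(X)$. - $R(x)=\{y\mid(x,y)\in R\}$. Refined subroutine $\mathrm{Ref}(R,\sigma)$. While there is $\langle a,x,x'\rangle$ with $R(x)\cap\sigma\neq\varnothing$, $x\xrightarrow{a}x'$ and $R(x)\not\subseteq\mathrm{pre}_a(R(x'))$, choose one and set $R(x):=R(x)\cap\mathrm{pre}_a(R(x'))$. Then return $\langle R,\sigma\rangle$. Algorithm 5. Initially $R:=R_i$, $\sigma:=\sigma_i$ and $U_{bad}:=\varnothing$. The algorithm repeats the following forever. - Compute \[U=\{x\mid\neg\exists s\in\sigma.\ R(x)=R(s),\ R(x)\cap\mathrm{post}(\sigma)\neq\varnothing\}\] and \[V=\{\langle a,x,x'\rangle\mid\exists s\in\sigma.\ R(x)=R(s),\ x\xrightarrow{a}x',\ R(x)\not\subseteq\mathrm{pre}_a(R(x'))\}.\] - Then nondeterministically execute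 one enabled guarded command: - (Search) if $U\setminus U_{bad}\neq\varnothing$: choose $x\in U\setminus U_{bad}$ and let $S:=(R(x)\cap\mathrm{post}(\sigma))\setminus\sigma$. - If $S\neq\varnothing$: choose $s\in S$, set $\sigma:=\sigma\cup\{s\}$ and $U_{bad}:=\varnothing$. - Otherwise: set $U_{bad}:=U_{bad}\cup\{x\}$. - (Refine) if $V\neq\varnothing$: choose $\langle a,x,x'\rangle\in V$, set $R(x):=R(x)\cap\mathrm{pre}_a(R(x'))$ and $U_{bad}:=\varnothing$. - (Expand) if $U=U_{bad}\neq\varnothing$ and $V=\varnothing$: - If $\mathrm{post}(\sigma)\subseteq\sigma$: return $\mathrm{Ref}(R,\sigma)$. - Otherwise: set $\sigma:=\sigma\cup\mathrm{post}(\sigma)$ and $U_{bad}:=\varnothing$. - if $U=V=\varnothing$: return $\langle R,\sigma\rangle$. -}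

module Defs where

open import Data.Nat using (ℕ; zero; suc)
open import Data.Bool using (Bool; true; false; _∧_; _∨_; if_then_else_)
open import Data.Fin using (Fin; zero; suc)
open import Data.Fin.Properties using (_≟_)
open import Data.Fin.Subset using (Subset; _∈_; _∉_; _⊆_; _∩_; _∪_; _─_; ⊥; ⁅_⁆; Nonempty; Empty)
open import Data.Vec using (tabulate; lookup)
open import Data.Product using (Σ; ∃; ∃-syntax; _×_; _,_)
open import Data.Sum using (_⊎_)
open import Function using (_∘_; _⇔_)
open import Relation.Nullary using (¬_; yes; no)
open import Relation.Binary.PropositionalEquality using (_≡_)
open import Induction.WellFounded using (Acc)

existsᵇ : ∀ {n} → (Fin n → Bool) → Bool
existsᵇ {zero}  f = false
existsᵇ {suc n} f = f zero ∨ existsᵇ (f ∘ suc)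

-- A transition system G = (Σ, I, L, →) with finite state set Σ = Fin n
-- and finite label set L = Fin m; transitions given by a Boolean relation.
record TS (n m : ℕ) : Set where
  field
    I     : Subset n
    trans : Fin m → Fin n → Fin n → Bool

module _ {n m : ℕ} (G : TS n m) where
  open TS G

  Edge : Fin m → Fin n → Fin n → Set
  Edge a x y = trans a x y ≡ true

  pre : Fin m → Subset n → Subset n
  pre a Y = tabulate λ x → existsᵇ λ y → trans a x y ∧ lookup Y y

  post : Subset n → Subset n
  post X = tabulate λ y → existsᵇ λ x → lookup X x ∧ existsᵇ λ a → trans a x y

  postⁿ : ℕ → Subset n → Subset n
  postⁿ zero    X = X
  postⁿ (suc k) X = post (postⁿ k X)

  _∈post*_ : Fin n → Subset n → Set
  x ∈post* X = ∃[ k ] (x ∈ postⁿ k X)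

  -- A relation R on Σ, given by its rows R(x) = { y | (x,y) ∈ R }.
  Rel : Set
  Rel = Fin n → Subset n

  refineAt : Rel → Fin m → Fin n → Fin n → Rel
  refineAt R a x x' z with z ≟ x
  ... | yes _ = R x ∩ pre a (R x')
  ... | no  _ = R z

  SameAsSome : Rel → Subset n → Fin n → Set
  SameAsSome R σ x = ∃[ s ] (s ∈ σ × R x ≡ R s)

  InU : Rel → Subset n → Fin n → Set
  InU R σ x = ¬ SameAsSome R σ x × Nonempty (R x ∩ post σ)

  InV : Rel → Subset n → Fin m → Fin n → Fin n → Set
  InV R σ a x x' = SameAsSome R σ x × Edge a x x' × ¬ (R x ⊆ pre a (R x'))

  -- Configurations of Algorithm 5: the main loop ⟨R, σ, U_bad⟩, the loop of
  -- the subroutine Ref(R, σ) (σ fixed), and the returned state.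
  data Config : Set where
    main : Rel → Subset n → Subset n → Config
    ref  : Rel → Subset n → Config
    done : Config

  data Step : Config → Config → Set where
    search-add : ∀ {R σ Ub} x s →
      InU R σ x → x ∉ Ub →
      s ∈ ((R x ∩ post σ) ─ σ) →
      Step (main R σ Ub) (main R (σ ∪ ⁅ s ⁆) ⊥)
    search-bad : ∀ {R σ Ub} x →
      InU R σ x → x ∉ Ub →
      Empty ((R x ∩ post σ) ─ σ) →
      Step (main R σ Ub) (main R σ (Ub ∪ ⁅ x ⁆))
    refine : ∀ {R σ Ub} a x x' →
      InV R σ a x x' →
      Step (main R σ Ub) (main (refineAt R a x x') σ ⊥)
    expand-ref : ∀ {R σ Ub} →
      (∀ x → InU R σ x ⇔ x ∈ Ub) → (∃[ x ] InU R σ x) →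
      (∀ a x x' → ¬ InV R σ a x x') →
      post σ ⊆ σ →
      Step (main R σ Ub) (ref R σ)
    expand : ∀ {R σ Ub} →
      (∀ x → InU R σ x ⇔ x ∈ Ub) → (∃[ x ] InU R σ x) →
      (∀ a x x' → ¬ InV R σ a x x') →
      ¬ (post σ ⊆ σ) →
      Step (main R σ Ub) (main R (σ ∪ post σ) ⊥)
    finish : ∀ {R σ Ub} →
      (∀ x → ¬ InU R σ x) →
      (∀ a x x' → ¬ InV R σ a x x') →
      Step (main R σ Ub) done
    ref-step : ∀ {R σ} a x x' →
      Nonempty (R x ∩ σ) → Edge a x x' → ¬ (R x ⊆ pre a (R x')) →
      Step (ref R σ) (ref (refineAt R a x x') σ)
    ref-exit : ∀ {R σ} →
      (∀ a x x' → Nonempty (R x ∩ σ) → Edge a x x' → R x ⊆ pre a (R x')) →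
      Step (ref R σ) done

  IsPreorderRel : Rel → Set
  IsPreorderRel R = (∀ x → x ∈ R x) × (∀ x y z → y ∈ R x → z ∈ R y → z ∈ R x)

  Terminates : Config → Set
  Terminates = Acc (λ c' c → Step c c')

-- Every step of Algorithm 5 strictly decreases, lexicographically, the triple
-- (2·|R| + phase, |Σ ∖ σ|, |Σ ∖ U_bad|), where |R| counts the pairs of R and
-- the phase is 2 in the main loop, 1 inside Ref and 0 once returned: Refine
-- and the Ref loop shrink some row R(x) (so |R| drops), entering Ref lowers
-- the phase, Search-with-S≠∅ and Expand grow σ, and Search-with-S=∅ grows
-- U_bad. Termination therefore holds from every configuration.
module Submission where

open import Defs
open import Data.Nat using (ℕ; zero; suc; _+_; _<_; _≤_; z≤n; s≤s)
import Data.Nat.Properties as ℕ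
open import Data.Nat.Induction using (<-wellFounded)
open import Data.Fin using (Fin; zero; suc)
open import Data.Fin.Properties using (_≟_; any?)
open import Data.Fin.Subset using (Subset; _⊆_; _∈_; ⊥; _∉_; _⊂_; _∩_; _∪_; _─_; ⁅_⁆; ∁; ∣_∣; outside)
open import Data.Fin.Subset.Properties
  using (_∈?_; p∩q⊆p; x∈p∩q⁻; p⊆p∪q; q⊆p∪q; x∈⁅x⁆; p⊆q⇒∣p∣≤∣q∣; p⊂q⇒∣p∣<∣q∣; p⊂q⇒∁p⊃∁q)
open import Data.Vec using (_∷_; here; there)
open import Data.Product using (∃-syntax; _×_; _,_; proj₂)
open import Data.Product.Relation.Binary.Lex.Strict using (×-Lex; ×-wellFounded)
open import Data.Sum using (inj₁; inj₂)
open import Function using (_∘_)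
open import Relation.Nullary using (¬_; yes; no)
open import Relation.Nullary.Decidable using (_×-dec_; ¬?)
open import Relation.Nullary.Negation using (contradiction)
open import Relation.Binary.PropositionalEquality using (_≡_; refl)
open import Relation.Binary.Construct.On as On using ()
open import Induction.WellFounded using (WellFounded; module Subrelation)

x∈p─q⇒x∉q : ∀ {n} {x : Fin n} (p q : Subset n) → x ∈ p ─ q → x ∉ q
x∈p─q⇒x∉q (_ ∷ p) (outside ∷ q) here      ()
x∈p─q⇒x∉q (_ ∷ p) (_       ∷ q) (there x∈) (there x∈q) = x∈p─q⇒x∉q p q x∈ x∈q

p⊈q⇒∃∉ : ∀ {n} (p q : Subset n) → ¬ (p ⊆ q) → ∃[ y ] (y ∈ p × y ∉ q)
p⊈q⇒∃∉ p q p⊈q with any? (λ y → (y ∈? p) ×-dec ¬? (y ∈? q))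
... | yes witness = witness
... | no ¬witness = contradiction (λ {y} → p⊆q {y}) p⊈q
  where
  p⊆q : p ⊆ q
  p⊆q {y} y∈p with y ∈? q
  ... | yes y∈q = y∈q
  ... | no  y∉q = contradiction (y , y∈p , y∉q) ¬witness

p⊈q⇒p∩q⊂p : ∀ {n} (p q : Subset n) → ¬ (p ⊆ q) → p ∩ q ⊂ p
p⊈q⇒p∩q⊂p p q p⊈q with p⊈q⇒∃∉ p q p⊈q
... | y , y∈p , y∉q = p∩q⊆p p q , y , y∈p , y∉q ∘ proj₂ ∘ x∈p∩q⁻ p q

x∈q∧x∉p⇒p⊂p∪q : ∀ {n} {x : Fin n} (p q : Subset n) → x ∈ q → x ∉ p → p ⊂ p ∪ q
x∈q∧x∉p⇒p⊂p∪q p q x∈q x∉p = p⊆p∪q q , _ , q⊆p∪q p q x∈q , x∉p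

p⊂q⇒∣∁q∣<∣∁p∣ : ∀ {n} {p q : Subset n} → p ⊂ q → ∣ ∁ q ∣ < ∣ ∁ p ∣
p⊂q⇒∣∁q∣<∣∁p∣ = p⊂q⇒∣p∣<∣q∣ ∘ p⊂q⇒∁p⊃∁q

∑ : ∀ {n} → (Fin n → ℕ) → ℕ
∑ {zero}  f = 0
∑ {suc n} f = f zero + ∑ (f ∘ suc)

∑-mono-≤ : ∀ {n} {f g : Fin n → ℕ} → (∀ i → f i ≤ g i) → ∑ f ≤ ∑ g
∑-mono-≤ {zero}  f≤g = z≤n
∑-mono-≤ {suc n} f≤g = ℕ.+-mono-≤ (f≤g zero) (∑-mono-≤ (f≤g ∘ suc))

∑-mono-< : ∀ {n} {f g : Fin n → ℕ} (i : Fin n) → (∀ j → f j ≤ g j) → f i < g i → ∑ f < ∑ g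
∑-mono-< zero    f≤g fi<gi = ℕ.+-mono-<-≤ fi<gi (∑-mono-≤ (f≤g ∘ suc))
∑-mono-< (suc i) f≤g fi<gi = ℕ.+-mono-≤-< (f≤g zero) (∑-mono-< i (f≤g ∘ suc) fi<gi)

+-double-< : ∀ {a b} → a < b → a + a < b + b
+-double-< a<b = ℕ.+-mono-< a<b a<b

module _ {n m : ℕ} (G : TS n m) where

  ∣_∣ʳ : Rel G → ℕ
  ∣ R ∣ʳ = ∑ λ x → ∣ R x ∣

  refineAt-shrinks : ∀ (R : Rel G) a x x' → ¬ (R x ⊆ pre G a (R x')) →
                     ∣ refineAt G R a x x' ∣ʳ < ∣ R ∣ʳ
  refineAt-shrinks R a x x' R[x]⊈ = ∑-mono-< x row-≤ row-x-<
    where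
    row-≤ : ∀ z → ∣ refineAt G R a x x' z ∣ ≤ ∣ R z ∣
    row-≤ z with z ≟ x
    ... | yes refl = p⊆q⇒∣p∣≤∣q∣ (p∩q⊆p (R x) (pre G a (R x')))
    ... | no  _    = ℕ.≤-refl
    row-x-< : ∣ refineAt G R a x x' x ∣ < ∣ R x ∣
    row-x-< with x ≟ x
    ... | yes _   = p⊂q⇒∣p∣<∣q∣ (p⊈q⇒p∩q⊂p (R x) (pre G a (R x')) R[x]⊈)
    ... | no  x≢x = contradiction refl x≢x

  _<³_ : (ℕ × ℕ × ℕ) → (ℕ × ℕ × ℕ) → Set
  _<³_ = ×-Lex _≡_ _<_ (×-Lex _≡_ _<_ _<_)

  <³-wellFounded : WellFounded _<³_
  <³-wellFounded = ×-wellFounded <-wellFounded (×-wellFounded <-wellFounded <-wellFounded)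

  rank : Config G → ℕ × ℕ × ℕ
  rank (main R σ Ub) = 2 + (∣ R ∣ʳ + ∣ R ∣ʳ) , ∣ ∁ σ ∣ , ∣ ∁ Ub ∣
  rank (ref R σ)     = 1 + (∣ R ∣ʳ + ∣ R ∣ʳ) , 0 , 0
  rank done          = 0 , 0 , 0

  step-decreases-rank : ∀ {c c'} → Step G c c' → rank c' <³ rank c
  step-decreases-rank (search-add {σ = σ} _ s _ _ s∈S) =
    inj₂ (refl , inj₁ (p⊂q⇒∣∁q∣<∣∁p∣ (x∈q∧x∉p⇒p⊂p∪q σ ⁅ s ⁆ (x∈⁅x⁆ s) (x∈p─q⇒x∉q _ σ s∈S))))
  step-decreases-rank (search-bad {Ub = Ub} x _ x∉Ub _) =
    inj₂ (refl , inj₂ (refl , p⊂q⇒∣∁q∣<∣∁p∣ (x∈q∧x∉p⇒p⊂p∪q Ub ⁅ x ⁆ (x∈⁅x⁆ x) x∉Ub)))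
  step-decreases-rank (refine {R} a x x' (_ , _ , R[x]⊈)) =
    inj₁ (s≤s (s≤s (+-double-< (refineAt-shrinks R a x x' R[x]⊈))))
  step-decreases-rank (expand-ref _ _ _ _) = inj₁ (ℕ.n<1+n _)
  step-decreases-rank (expand {σ = σ} _ _ _ post⊈σ) with p⊈q⇒∃∉ (post G σ) σ post⊈σ
  ... | _ , y∈post , y∉σ = inj₂ (refl , inj₁ (p⊂q⇒∣∁q∣<∣∁p∣ (x∈q∧x∉p⇒p⊂p∪q σ (post G σ) y∈post y∉σ)))
  step-decreases-rank (finish _ _) = inj₁ (s≤s z≤n)
  step-decreases-rank (ref-step {R} a x x' _ _ R[x]⊈) =
    inj₁ (s≤s (+-double-< (refineAt-shrinks R a x x' R[x]⊈)))
  step-decreases-rank (ref-exit _) = inj₁ (s≤s z≤n)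

  every-execution-terminates : ∀ c → Terminates G c
  every-execution-terminates =
    Subrelation.wellFounded step-decreases-rank (On.wellFounded rank <³-wellFounded)

theorem8 : ∀ {n m} (G : TS n m) (σi : Subset n) (Ri : Rel G) →
    TS.I G ⊆ σi → (∀ x → x ∈ σi → _∈post*_ G x (TS.I G)) →
    IsPreorderRel G Ri →
    Terminates G (main Ri σi ⊥)
theorem8 G σi Ri _ _ _ = every-execution-terminates G (main Ri σi ⊥)
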